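{- If $u$ is a nonempty sequence and $v$ is obtained from $u$ by inserting a single occurrence of a letter which has no occurrence in $u$, then $\mathit{fw}(u)= \mathit{fw}(v)$.
   Context: A sequence $s$ contains a sequence $u$ if some subsequence of $s$ can be changed into $u$ by a one-to-one renaming of its letters. An $(r,s)$-formation is a concatenation of $s$ permutations of the same set of $r$ distinct letters. The formation width $\mathit{fw}(u)$ is the minimum $s$ such that there exists $r$ for which every $(r,s)$-formation contains $u$. -}

module Defs where

open import Data.Nat using (ℕ; _≤_)
open import Data.List using (List; []; _∷_; _++_; map; concat; length)
open import Data.List.Relation.Binary.Sublist.Propositional using (_⊆_)
open import Data.List.Relation.Binary.Permutation.Propositional using (_↭_)
open import Data.List.Relation.Unary.All using (All)
open import Data.List.Relation.Unary.Unique.Propositional using (Unique)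
open import Data.List.Membership.Propositional using (_∈_)
open import Data.Product using (Σ; ∃; ∃-syntax; _×_)
open import Relation.Binary.PropositionalEquality using (_≡_)

Seq : Set
Seq = List ℕ

InjectiveOn : (ℕ → ℕ) → Seq → Set
InjectiveOn f w = ∀ {x y} → x ∈ w → y ∈ w → f x ≡ f y → x ≡ y

Contains : Seq → Seq → Set
Contains s u = ∃[ w ] (w ⊆ s × ∃[ f ] (InjectiveOn f w × map f w ≡ u))

IsFormation : ℕ → ℕ → Seq → Set
IsFormation r s f =
  ∃[ L ] (Unique L × length L ≡ r ×
    ∃[ ps ] (length ps ≡ s × All (_↭ L) ps × f ≡ concat ps))

FWWitness : Seq → ℕ → Set
FWWitness u s = ∃[ r ] (∀ f → IsFormation r s f → Contains f u)

IsFW : Seq → ℕ → Set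
IsFW u s = FWWitness u s × (∀ t → FWWitness u t → s ≤ t)

-- Deleting the new letter from an occurrence of v leaves one of u, so fw(u) ≤ fw(v).
-- Conversely, let every (r,s)-formation contain u, and take a formation on an
-- alphabet of size shrinkBound r s. Going through its s permutations and keeping
-- each time every second remaining letter in the order of that permutation (never
-- the first or the last) leaves r letters T which, in every permutation, are
-- neither first nor last nor adjacent to each other. The restriction to T is an
-- (r,s)-formation, so it contains u; a letter outside T then lies at the insertion
-- point of that occurrence, and renaming it to the new letter yields an occurrence
-- of v. Hence fw(v) ≤ fw(u).
module Submission where

open import Defs
open import Data.Nat using (ℕ; zero; suc; _+_; _*_; _≤_; z≤n; s≤s; _≟_)
open import Data.Nat.Properties
  using (≤-reflexive; +-cancelˡ-≤; *-cancelˡ-≤; *-suc; m≤n⇒m⊓n≡m; module ≤-Reasoning)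
open import Data.List using (List; []; _∷_; [_]; _++_; map; concat; length; filter; take)
open import Data.List.Properties
  using (∷-injective; ++-assoc; map-++; map-cong-local; filter-++; length-map; length-take)
open import Data.List.Relation.Binary.Sublist.Propositional using (_⊆_; []; _∷_; _∷ʳ_; ⊆-refl; ⊆-trans; lookup)
open import Data.List.Relation.Binary.Sublist.Propositional.Properties
  using (All-resp-⊆; filter-⊆; take-⊆; ++⁺)
open import Data.List.Relation.Binary.Permutation.Propositional using (_↭_; ↭-refl; ↭-sym; ↭-trans; ↭⇒↭ₛ)
open import Data.List.Relation.Binary.Permutation.Propositional.Properties
  using (∈-resp-↭; ↭-length; filter-↭; shift)
import Data.List.Relation.Binary.Permutation.Setoid.Properties as ↭ₛ
open import Data.List.Relation.Binary.BagAndSetEquality using (∼bag⇒↭)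
open import Data.List.Relation.Unary.All as All using (All; []; _∷_)
open import Data.List.Relation.Unary.All.Properties using (all-filter; map⁺)
open import Data.List.Relation.Unary.Any using (here; there)
open import Data.List.Relation.Unary.Unique.Propositional using (Unique; []; _∷_)
open import Data.List.Relation.Unary.Unique.Propositional.Properties using (Unique[x∷xs]⇒x∉xs)
import Data.List.Relation.Unary.Unique.Propositional.Properties as Unique
open import Data.List.Membership.Propositional using (_∈_; _∉_)
open import Data.List.Membership.Propositional.Properties using (∈-map⁺; ∈-++⁺ˡ; ∈-++⁺ʳ; ∈-filter⁺; ∈-filter⁻)
open import Data.List.Membership.Propositional.Properties.WithK using (unique∧set⇒bag)
open import Data.List.Membership.DecPropositional _≟_ using (_∈?_)
open import Data.Product using (∃-syntax; ∃₂; _×_; _,_; proj₂)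
open import Data.Empty using (⊥-elim)
open import Function using (_∘_; id)
open import Function.Bundles using (mk⇔)
open import Relation.Nullary using (¬_; yes; no)
open import Relation.Unary using (Decidable)
open import Relation.Binary.PropositionalEquality
  using (_≡_; _≢_; refl; sym; trans; cong; cong₂; subst; subst₂; setoid; module ≡-Reasoning)

private
  variable
    A B : Set
    x : A
    xs ys zs ws ws₁ ws₂ : List A

map-++⁻ : ∀ (g : A → B) ws {xs ys} → map g ws ≡ xs ++ ys →
          ∃₂ λ ws₁ ws₂ → ws ≡ ws₁ ++ ws₂ × map g ws₁ ≡ xs × map g ws₂ ≡ ys
map-++⁻ g ws {[]} eq = [] , ws , refl , refl , eq
map-++⁻ g [] {_ ∷ _} ()
map-++⁻ g (w ∷ ws) {_ ∷ xs} eq with gw≡x , eq′ ← ∷-injective eq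
                             with ws₁ , ws₂ , refl , refl , refl ← map-++⁻ g ws {xs} eq′
  = w ∷ ws₁ , ws₂ , refl , cong (_∷ map g ws₁) gw≡x , refl

⊆-map⁻ : ∀ {g : A → B} {us} → us ⊆ map g ws → ∃[ vs ] (vs ⊆ ws × map g vs ≡ us)
⊆-map⁻ {ws = []} [] = [] , [] , refl
⊆-map⁻ {ws = w ∷ ws} (_ ∷ʳ σ) with vs , τ , eq ← ⊆-map⁻ σ = vs , w ∷ʳ τ , eq
⊆-map⁻ {ws = w ∷ ws} (refl ∷ σ) with vs , τ , refl ← ⊆-map⁻ σ = w ∷ vs , refl ∷ τ , refl

filter-concat : ∀ {P : A → Set} (P? : Decidable P) xss →
                filter P? (concat xss) ≡ concat (map (filter P?) xss)
filter-concat P? [] = refl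
filter-concat P? (xs ∷ xss) =
  trans (filter-++ P? xs (concat xss)) (cong (filter P? xs ++_) (filter-concat P? xss))

Unique-⊆ : xs ⊆ ys → Unique ys → Unique xs
Unique-⊆ [] [] = []
Unique-⊆ (_ ∷ʳ σ) (_ ∷ u) = Unique-⊆ σ u
Unique-⊆ (refl ∷ σ) (x≢ ∷ u) = All-resp-⊆ σ x≢ ∷ Unique-⊆ σ u

Unique-↭ : xs ↭ ys → Unique ys → Unique xs
Unique-↭ σ = ↭ₛ.Unique-resp-↭ (setoid _) (↭⇒↭ₛ (↭-sym σ))

⊆-skip : ∀ {P : A → Set} → ¬ P x → All P ws → ws ⊆ x ∷ xs → ws ⊆ xs
⊆-skip ¬px _ (_ ∷ʳ σ) = σ
⊆-skip ¬px (px ∷ _) (refl ∷ _) = ⊥-elim (¬px px)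

-- Every P-letter has a non-P letter immediately before and after it.
data Isolated {A : Set} (P : A → Set) : List A → Set where
  []    : Isolated P []
  _∷_   : ¬ P x → Isolated P xs → Isolated P (x ∷ xs)
  flank : ∀ {y z} → ¬ P x → P y → Isolated P (z ∷ xs) → Isolated P (x ∷ y ∷ z ∷ xs)

module _ {P : A → Set} where

  Isolated-head : Isolated P (x ∷ xs) → ¬ P x
  Isolated-head (¬px ∷ _) = ¬px
  Isolated-head (flank ¬px _ _) = ¬px

  Isolated-++ : Isolated P xs → Isolated P ys → Isolated P (xs ++ ys)
  Isolated-++ [] iys = iys
  Isolated-++ (¬px ∷ ixs) iys = ¬px ∷ Isolated-++ ixs iys
  Isolated-++ (flank ¬px py ixs) iys = flank ¬px py (Isolated-++ ixs iys)

  Isolated-concat : ∀ {xss} → All (Isolated P) xss → Isolated P (concat xss)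
  Isolated-concat [] = []
  Isolated-concat (ixs ∷ ixss) = Isolated-++ ixs (Isolated-concat ixss)

  Isolated-mono : ∀ {Q : A → Set} → Decidable Q → (∀ {x} → x ∈ xs → Q x → P x) →
                  Isolated P xs → Isolated Q xs
  Isolated-mono Q? Q⇒P [] = []
  Isolated-mono Q? Q⇒P (¬px ∷ i) = ¬px ∘ Q⇒P (here refl) ∷ Isolated-mono Q? (Q⇒P ∘ there) i
  Isolated-mono Q? Q⇒P (flank {y = y} ¬px _ i) with Q? y
  ... | yes qy = flank (¬px ∘ Q⇒P (here refl)) qy (Isolated-mono Q? (Q⇒P ∘ there ∘ there) i)
  ... | no ¬qy = ¬px ∘ Q⇒P (here refl) ∷ ¬qy ∷ Isolated-mono Q? (Q⇒P ∘ there ∘ there) i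

  Isolated-insert : ∀ xs {n} → ¬ P n → Isolated P (xs ++ ys) → Isolated P (xs ++ n ∷ ys)
  Isolated-insert [] ¬pn i = ¬pn ∷ i
  Isolated-insert (_ ∷ []) ¬pn (¬px ∷ i) = ¬px ∷ ¬pn ∷ i
  Isolated-insert (_ ∷ []) ¬pn (flank ¬px py i) = ¬px ∷ flank ¬pn py i
  Isolated-insert (_ ∷ y ∷ []) ¬pn (¬px ∷ i) = ¬px ∷ Isolated-insert (y ∷ []) ¬pn i
  Isolated-insert (_ ∷ _ ∷ []) ¬pn (flank ¬px py i) = flank ¬px py (¬pn ∷ i)
  Isolated-insert (_ ∷ y ∷ z ∷ xs) ¬pn (¬px ∷ i) = ¬px ∷ Isolated-insert (y ∷ z ∷ xs) ¬pn i
  Isolated-insert (_ ∷ _ ∷ z ∷ xs) ¬pn (flank ¬px py i) = flank ¬px py (Isolated-insert (z ∷ xs) ¬pn i)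

  Isolated-filter⁻ : ∀ {Q : A → Set} (Q? : Decidable Q) → (∀ {x} → P x → Q x) →
                     Isolated P (filter Q? xs) → Isolated P xs
  Isolated-filter⁻ {xs = xs} Q? P⇒Q = lift [] xs
    where
    lift : ∀ ws xs → Isolated P (ws ++ filter Q? xs) → Isolated P (ws ++ xs)
    lift ws [] i = i
    lift ws (x ∷ xs) i with Q? x
    ... | yes _ = subst (Isolated P) (++-assoc ws [ x ] xs)
                    (lift (ws ++ [ x ]) xs (subst (Isolated P) (sym (++-assoc ws [ x ] (filter Q? xs))) i))
    ... | no ¬qx = Isolated-insert ws (¬qx ∘ P⇒Q) (lift ws xs i)

  Separator : List A → List A → List A → Set
  Separator ws₁ ws₂ zs = ∃[ c ] (¬ P c × ws₁ ++ c ∷ ws₂ ⊆ zs)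

  Isolated-separator : Isolated P zs → ∀ ws₁ → All P (ws₁ ++ ws₂) → ws₁ ++ ws₂ ≢ [] →
              ws₁ ++ ws₂ ⊆ zs → Separator ws₁ ws₂ zs
  Isolated-separator [] [] _ ne [] = ⊥-elim (ne refl)
  Isolated-separator [] (_ ∷ _) _ _ ()
  Isolated-separator (¬px ∷ _) [] pws _ σ = _ , ¬px , refl ∷ ⊆-skip ¬px pws σ
  Isolated-separator (flank ¬px _ _) [] pws _ σ = _ , ¬px , refl ∷ ⊆-skip ¬px pws σ
  Isolated-separator (¬px ∷ i) (w ∷ ws₁) pws _ σ
    with c , ¬pc , τ ← Isolated-separator i (w ∷ ws₁) pws (λ ()) (⊆-skip ¬px pws σ) = c , ¬pc , _ ∷ʳ τ
  Isolated-separator (flank ¬px _ i) (w ∷ ws₁) pws _ σ with ⊆-skip ¬px pws σ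
  ... | _ ∷ʳ σ′ with c , ¬pc , τ ← Isolated-separator i (w ∷ ws₁) pws (λ ()) σ′ = c , ¬pc , _ ∷ʳ _ ∷ʳ τ
  Isolated-separator (flank ¬px _ i) (w ∷ []) (_ ∷ pws) _ σ | refl ∷ σ′ =
    _ , Isolated-head i , _ ∷ʳ refl ∷ refl ∷ ⊆-skip (Isolated-head i) pws σ′
  Isolated-separator (flank ¬px _ i) (w ∷ v ∷ ws₁) (_ ∷ pws) _ σ | refl ∷ σ′
    with c , ¬pc , τ ← Isolated-separator i (v ∷ ws₁) pws (λ ()) σ′ = c , ¬pc , _ ∷ʳ refl ∷ τ

half : List A → List A
half (_ ∷ y ∷ z ∷ zs) = y ∷ half (z ∷ zs)
half _ = []

half-⊆ : ∀ (xs : List A) → half xs ⊆ xs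
half-⊆ [] = []
half-⊆ (_ ∷ []) = _ ∷ʳ []
half-⊆ (_ ∷ _ ∷ []) = _ ∷ʳ _ ∷ʳ []
half-⊆ (_ ∷ _ ∷ z ∷ zs) = _ ∷ʳ refl ∷ half-⊆ (z ∷ zs)

length-half : ∀ (xs : List A) → length xs ≤ 2 + 2 * length (half xs)
length-half [] = z≤n
length-half (_ ∷ []) = s≤s z≤n
length-half (_ ∷ _ ∷ []) = s≤s (s≤s z≤n)
length-half (x ∷ y ∷ z ∷ zs) = begin
  2 + length (z ∷ zs)                  ≤⟨ s≤s (s≤s (length-half (z ∷ zs))) ⟩
  2 + (2 + 2 * length (half (z ∷ zs))) ≡⟨ cong (2 +_) (*-suc 2 (length (half (z ∷ zs)))) ⟨
  2 + 2 * length (half (x ∷ y ∷ z ∷ zs)) ∎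
  where open ≤-Reasoning

Isolated-half : ∀ {xs : List ℕ} → Unique xs → Isolated (_∈ half xs) xs
Isolated-half {[]} _ = []
Isolated-half {_ ∷ []} _ = (λ ()) ∷ []
Isolated-half {_ ∷ _ ∷ []} _ = (λ ()) ∷ (λ ()) ∷ []
Isolated-half {x ∷ y ∷ z ∷ zs} u@(_ ∷ u′@(_ ∷ u″)) =
  flank (Unique[x∷xs]⇒x∉xs u ∘ lookup (refl ∷ half-⊆ (z ∷ zs))) (here refl)
        (Isolated-mono (_∈? y ∷ half (z ∷ zs)) drop-y (Isolated-half u″))
  where
  drop-y : ∀ {v} → v ∈ z ∷ zs → v ∈ y ∷ half (z ∷ zs) → v ∈ half (z ∷ zs)
  drop-y v∈ (here refl) = ⊥-elim (Unique[x∷xs]⇒x∉xs u′ v∈)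
  drop-y _ (there v∈) = v∈

filter-∈-↭ : ∀ {L S p : List ℕ} → Unique L → Unique S → (∀ {x} → x ∈ S → x ∈ L) →
             p ↭ L → filter (_∈? S) p ↭ S
filter-∈-↭ {L} {S} uL uS S⊆L p↭L = ↭-trans (filter-↭ (_∈? S) p↭L)
  (∼bag⇒↭ (unique∧set⇒bag (Unique.filter⁺ (_∈? S) uL) uS
    (mk⇔ (proj₂ ∘ ∈-filter⁻ (_∈? S) {xs = L}) (λ x∈S → ∈-filter⁺ (_∈? S) (S⊆L x∈S) x∈S))))

restrict-formation : ∀ {L T : List ℕ} {ps r} → Unique L → All (_↭ L) ps → T ⊆ L → length T ≡ r →
                     IsFormation r (length ps) (filter (_∈? T) (concat ps))
restrict-formation {L} {T} {ps} uL ps↭L T⊆L |T|≡r =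
  T , uT , |T|≡r , map (filter (_∈? T)) ps , length-map _ ps ,
  map⁺ (All.map (filter-∈-↭ uL uT (lookup T⊆L)) ps↭L) , filter-concat (_∈? T) ps
  where
  uT : Unique T
  uT = Unique-⊆ T⊆L uL

shrink : List ℕ → List (List ℕ) → List ℕ
shrink S [] = S
shrink S (p ∷ ps) = shrink (half (filter (_∈? S) p)) ps

shrinkBound : ℕ → ℕ → ℕ
shrinkBound r zero = r
shrinkBound r (suc s) = 2 + 2 * shrinkBound r s

half-filter-⊆ : ∀ {S p : List ℕ} {x} → x ∈ half (filter (_∈? S) p) → x ∈ S
half-filter-⊆ {S} {p} = proj₂ ∘ ∈-filter⁻ (_∈? S) {xs = p} ∘ lookup (half-⊆ _)

Unique-half-filter : ∀ {S p : List ℕ} → Unique p → Unique (half (filter (_∈? S) p))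
Unique-half-filter {S} up = Unique-⊆ (half-⊆ _) (Unique.filter⁺ (_∈? S) up)

shrink-⊆ : ∀ S ps {x} → x ∈ shrink S ps → x ∈ S
shrink-⊆ S [] = id
shrink-⊆ S (p ∷ ps) = half-filter-⊆ {S} {p} ∘ shrink-⊆ _ ps

module _ {L : List ℕ} (uL : Unique L) where

  shrink-unique : ∀ {ps} → All (_↭ L) ps → ∀ {S} → Unique S → Unique (shrink S ps)
  shrink-unique [] uS = uS
  shrink-unique (p↭L ∷ ps↭L) _ = shrink-unique ps↭L (Unique-half-filter (Unique-↭ p↭L uL))

  shrink-length : ∀ {r ps} → All (_↭ L) ps → ∀ {S} → Unique S → (∀ {x} → x ∈ S → x ∈ L) →
                  shrinkBound r (length ps) ≤ length S → r ≤ length (shrink S ps)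
  shrink-length [] _ _ bound = bound
  shrink-length {r} {p ∷ ps} (p↭L ∷ ps↭L) {S} uS S⊆L bound =
    shrink-length ps↭L (Unique-half-filter (Unique-↭ p↭L uL)) (S⊆L ∘ half-filter-⊆ {S} {p}) halved
    where
    l = filter (_∈? S) p
    open ≤-Reasoning
    halved : shrinkBound r (length ps) ≤ length (half l)
    halved = *-cancelˡ-≤ 2 (+-cancelˡ-≤ 2 _ _ (begin
      2 + 2 * shrinkBound r (length ps) ≤⟨ bound ⟩
      length S                          ≡⟨ ↭-length (filter-∈-↭ uL uS S⊆L p↭L) ⟨
      length l                          ≤⟨ length-half l ⟩
      2 + 2 * length (half l)           ∎))

  shrink-isolated : ∀ {ps} → All (_↭ L) ps → ∀ S → All (Isolated (_∈ shrink S ps)) ps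
  shrink-isolated [] S = []
  shrink-isolated {p ∷ ps} (p↭L ∷ ps↭L) S =
    Isolated-mono (_∈? shrink S′ ps) (λ _ → shrink-⊆ S′ ps)
      (Isolated-filter⁻ (_∈? S) (half-filter-⊆ {S} {p})
        (Isolated-half (Unique.filter⁺ (_∈? S) (Unique-↭ p↭L uL))))
    ∷ shrink-isolated ps↭L S′
    where S′ = half (filter (_∈? S) p)

  isolating-subset : ∀ {r ps} → All (_↭ L) ps → shrinkBound r (length ps) ≤ length L →
                     ∃[ T ] (T ⊆ L × length T ≡ r × All (Isolated (_∈ T)) ps)
  isolating-subset {r} {ps} ps↭L bound =
    T , T⊆L , |T|≡r , All.map (Isolated-mono (_∈? T) (λ _ → T⊆S)) (shrink-isolated ps↭L L)
    where
    S = shrink L ps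
    l = filter (_∈? S) L
    T = take r l
    T⊆L : T ⊆ L
    T⊆L = ⊆-trans (take-⊆ r l) (filter-⊆ (_∈? S) L)
    T⊆S : ∀ {x} → x ∈ T → x ∈ S
    T⊆S = proj₂ ∘ ∈-filter⁻ (_∈? S) {xs = L} ∘ lookup (take-⊆ r l)
    open ≤-Reasoning
    |T|≡r : length T ≡ r
    |T|≡r = trans (length-take r l) (m≤n⇒m⊓n≡m (begin
      r        ≤⟨ shrink-length ps↭L uL id bound ⟩
      length S ≡⟨ ↭-length (filter-∈-↭ uL (shrink-unique ps↭L uL) (shrink-⊆ L ps) ↭-refl) ⟨
      length l ∎))

_[_↦_] : (ℕ → ℕ) → ℕ → ℕ → ℕ → ℕ
(g [ c ↦ a ]) x with x ≟ c
... | yes _ = a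
... | no _ = g x

↦-hit : ∀ {g c a} → (g [ c ↦ a ]) c ≡ a
↦-hit {c = c} with c ≟ c
... | yes _ = refl
... | no c≢c = ⊥-elim (c≢c refl)

↦-miss : ∀ {g c a x} → x ≢ c → (g [ c ↦ a ]) x ≡ g x
↦-miss {c = c} {x = x} x≢c with x ≟ c
... | yes x≡c = ⊥-elim (x≢c x≡c)
... | no _ = refl

module _ {f : ℕ → ℕ} where

  InjectiveOn-↭ : ws ↭ zs → InjectiveOn f ws → InjectiveOn f zs
  InjectiveOn-↭ σ inj x∈ y∈ = inj (∈-resp-↭ (↭-sym σ) x∈) (∈-resp-↭ (↭-sym σ) y∈)

  InjectiveOn-cong : ∀ {g} → (∀ {x} → x ∈ ws → f x ≡ g x) → InjectiveOn g ws → InjectiveOn f ws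
  InjectiveOn-cong f≡g inj x∈ y∈ fx≡fy = inj x∈ y∈ (trans (sym (f≡g x∈)) (trans fx≡fy (f≡g y∈)))

  InjectiveOn-∷ : ∀ {c} → f c ∉ map f ws → InjectiveOn f ws → InjectiveOn f (c ∷ ws)
  InjectiveOn-∷ _ _ (here refl) (here refl) _ = refl
  InjectiveOn-∷ {ws = ws} fc∉ _ (here refl) (there y∈) fc≡fy =
    ⊥-elim (fc∉ (subst (_∈ map f ws) (sym fc≡fy) (∈-map⁺ f y∈)))
  InjectiveOn-∷ {ws = ws} fc∉ _ (there x∈) (here refl) fx≡fc =
    ⊥-elim (fc∉ (subst (_∈ map f ws) fx≡fc (∈-map⁺ f x∈)))
  InjectiveOn-∷ _ inj (there x∈) (there y∈) = inj x∈ y∈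

rename-insert : ∀ {g c a} ws₁ ws₂ → InjectiveOn g (ws₁ ++ ws₂) → c ∉ ws₁ ++ ws₂ →
                a ∉ map g ws₁ ++ map g ws₂ →
                InjectiveOn (g [ c ↦ a ]) (ws₁ ++ c ∷ ws₂) ×
                map (g [ c ↦ a ]) (ws₁ ++ c ∷ ws₂) ≡ map g ws₁ ++ a ∷ map g ws₂
rename-insert {g} {c} {a} ws₁ ws₂ inj c∉ a∉ =
  InjectiveOn-↭ (↭-sym (shift c ws₁ ws₂)) (InjectiveOn-∷ fc∉ (InjectiveOn-cong agree inj)) , map-f
  where
  f = g [ c ↦ a ]
  agree : ∀ {x} → x ∈ ws₁ ++ ws₂ → f x ≡ g x
  agree x∈ = ↦-miss λ x≡c → c∉ (subst (_∈ _) x≡c x∈)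
  map-agree : ∀ ws → (∀ {x} → x ∈ ws → x ∈ ws₁ ++ ws₂) → map f ws ≡ map g ws
  map-agree ws ⊆ws = map-cong-local (All.tabulate (agree ∘ ⊆ws))
  fc∉ : f c ∉ map f (ws₁ ++ ws₂)
  fc∉ = subst₂ _∉_ (sym (↦-hit {g} {c} {a}))
          (sym (trans (map-agree (ws₁ ++ ws₂) id) (map-++ g ws₁ ws₂))) a∉
  open ≡-Reasoning
  map-f : map f (ws₁ ++ c ∷ ws₂) ≡ map g ws₁ ++ a ∷ map g ws₂
  map-f = begin
    map f (ws₁ ++ c ∷ ws₂)       ≡⟨ map-++ f ws₁ (c ∷ ws₂) ⟩
    map f ws₁ ++ f c ∷ map f ws₂ ≡⟨ cong₂ _++_ (map-agree ws₁ ∈-++⁺ˡ)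
                                      (cong₂ _∷_ (↦-hit {g} {c} {a}) (map-agree ws₂ (∈-++⁺ʳ ws₁))) ⟩
    map g ws₁ ++ a ∷ map g ws₂   ∎

Contains-⊆ : ∀ {u v} → u ⊆ v → Contains zs v → Contains zs u
Contains-⊆ σ (ws , ws⊆zs , g , inj , refl) with vs , τ , refl ← ⊆-map⁻ σ =
  vs , ⊆-trans τ ws⊆zs , g , (λ x∈ y∈ → inj (lookup τ x∈) (lookup τ y∈)) , refl

Contains-insert : ∀ {P : ℕ → Set} {g xs ys a} → Isolated P zs → ws ⊆ zs → All P ws →
                  InjectiveOn g ws → map g ws ≡ xs ++ ys → xs ++ ys ≢ [] → a ∉ xs ++ ys →
                  Contains zs (xs ++ a ∷ ys)
Contains-insert {ws = ws} {g = g} {xs} {ys} iso ws⊆zs pws inj gws ne a∉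
  with ws₁ , ws₂ , refl , refl , refl ← map-++⁻ g ws {xs} {ys} gws
  with c , ¬pc , sep ← Isolated-separator iso ws₁ pws
                          (ne ∘ trans (sym (map-++ g ws₁ ws₂)) ∘ cong (map g)) ws⊆zs =
  ws₁ ++ c ∷ ws₂ , sep , _ , rename-insert ws₁ ws₂ inj (¬pc ∘ All.lookup pws) a∉

AllFormationsContain : ℕ → ℕ → Seq → Set
AllFormationsContain r s u = ∀ f → IsFormation r s f → Contains f u

AllFormationsContain-insert : ∀ {r s xs ys a} → xs ++ ys ≢ [] → a ∉ xs ++ ys →
                              AllFormationsContain r s (xs ++ ys) →
                              AllFormationsContain (shrinkBound r s) s (xs ++ a ∷ ys)
AllFormationsContain-insert ne a∉ contains _ (L , uL , |L| , ps , refl , ps↭L , refl)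
  with T , T⊆L , |T|≡r , isolated ← isolating-subset uL ps↭L (≤-reflexive (sym |L|))
  with ws , ws⊆ , g , inj , gws ← contains _ (restrict-formation uL ps↭L T⊆L |T|≡r) =
  Contains-insert (Isolated-concat isolated) (⊆-trans ws⊆ (filter-⊆ (_∈? T) _))
    (All-resp-⊆ ws⊆ (all-filter (_∈? T) (concat ps))) inj gws ne a∉

FWWitness-insert : ∀ {xs ys a s} → xs ++ ys ≢ [] → a ∉ xs ++ ys →
                   FWWitness (xs ++ ys) s → FWWitness (xs ++ a ∷ ys) s
FWWitness-insert {s = s} ne a∉ (r , contains) =
  shrinkBound r s , AllFormationsContain-insert ne a∉ contains

FWWitness-delete : ∀ {xs ys a s} → FWWitness (xs ++ a ∷ ys) s → FWWitness (xs ++ ys) s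
FWWitness-delete {a = a} (r , contains) =
  r , λ f isFormation → Contains-⊆ (++⁺ ⊆-refl (a ∷ʳ ⊆-refl)) (contains f isFormation)

IsFW-cong : ∀ {u v s} → (∀ {t} → FWWitness u t → FWWitness v t) →
            (∀ {t} → FWWitness v t → FWWitness u t) → IsFW u s → IsFW v s
IsFW-cong u⇒v v⇒u (witness , least) = u⇒v witness , λ t → least t ∘ v⇒u

corollary2p3 : (xs ys : Seq) (a : ℕ) → xs ++ ys ≢ [] → a ∉ xs ++ ys →
    (s : ℕ) → (IsFW (xs ++ ys) s → IsFW (xs ++ a ∷ ys) s) × (IsFW (xs ++ a ∷ ys) s → IsFW (xs ++ ys) s)
corollary2p3 xs ys a ne a∉ s =
  IsFW-cong (FWWitness-insert ne a∉) FWWitness-delete ,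
  IsFW-cong FWWitness-delete (FWWitness-insert ne a∉)
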